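{- Let $G=(V,E)$ be a graph and $(k(v))_{v\in V}$ with $k(v)\in\{0,\dots,d_G(v)\}$. Construct a graph $G'$ and labelling $f$ as follows: start with a copy of $G$ (its vertices are called original) and label every original vertex $1$; attach to each original vertex $v$ one path on two new vertices (one endpoint adjacent to $v$), both labelled $0$; let $B(v)=2k(v)+1-d_G(v)$; if $B(v)\ge 0$ attach to $v$ $B(v)$ copies of a path on three new vertices labelled $1,0,0$ in order, the vertex labelled $1$ being adjacent to $v$; if $B(v)<0$ attach to $v$ $|B(v)|$ copies of a path on two new vertices labelled $0,0$, one endpoint adjacent to $v$. Then solutions of Eliminating Illusion on $(G',f)$ correspond to solutions of Total Vector Domination on $(G,k)$, restricted to the original vertices: for every $S\subseteq V$, relabelling exactly the vertices of $S$ to $0$ yields a labelling of $G'$ inducing no illusion if and only if $|S\cap N_G(v)|\ge k(v)$ for all $v\in V$; and the minimum size of a labelling $f'$ of $G'$ inducing no illusion (size $|\{u: f(u)\ne f'(u)\}|$) equals the minimum size of a Total Vector Domination solution of $(G,k)$.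
   Context: A vertex $v$ is under illusion by a labelling $f$ if $|\{u\in N(v): f(u)=1\}|>|\{u\in N(v):f(u)=0\}|$; a labelling induces no illusion if no vertex is under illusion by it. Total Vector Domination: given a graph $H$ and a vector $(k(v))_{v\in V(H)}$ with $k(v)\in\{0,\dots,d_H(v)\}$, find a minimum-size $S\subseteq V(H)$ with $|S\cap N_H(v)|\ge k(v)$ for all $v$. $d_G(v)$ is the degree of $v$ in $G$. -}

module Defs where

open import Data.Bool using (Bool; true; false; not; _∧_; _∨_; _xor_)
open import Data.Nat using (ℕ; zero; suc; _+_; _*_; _∸_; _≤_; _<_; _≡ᵇ_)
open import Data.Integer as ℤ using (ℤ; +_; -[1+_]; ∣_∣)
open import Data.Fin using (Fin; toℕ) renaming (zero to fz; suc to fs)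
import Data.Fin as Fin
open import Data.List using (List; length; filterᵇ; map; concatMap; allFin; _++_)
open import Data.Product using (Σ; ∃; ∃-syntax; _×_; _,_)
open import Relation.Nullary using (¬_; does)
open import Relation.Binary.PropositionalEquality using (_≡_)

-- Labels: a labelling is a map to Bool, with  true = label 1,
-- false = label 0.

-- Generic finite graph: a list enumerating the vertices (each exactly
-- once) and a Boolean adjacency relation.

record FinGraph : Set₁ where
  field
    Vtx      : Set
    vertices : List Vtx
    adj      : Vtx → Vtx → Bool

module _ (Γ : FinGraph) where
  open FinGraph Γ

  N : Vtx → List Vtx
  N v = filterᵇ (adj v) vertices

  deg : Vtx → ℕ
  deg v = length (N v)

  ones zeros : (Vtx → Bool) → Vtx → ℕ
  ones  f v = length (filterᵇ f (N v))
  zeros f v = length (filterᵇ (λ u → not (f u)) (N v))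

  UnderIllusion : (Vtx → Bool) → Vtx → Set
  UnderIllusion f v = zeros f v < ones f v

  NoIllusion : (Vtx → Bool) → Set
  NoIllusion f = ∀ v → ¬ UnderIllusion f v

  dist : (Vtx → Bool) → (Vtx → Bool) → ℕ
  dist f f' = length (filterᵇ (λ u → f u xor f' u) vertices)

record SimpleGraph (n : ℕ) : Set where
  field
    adj    : Fin n → Fin n → Bool
    sym    : ∀ u v → adj u v ≡ adj v u
    irrefl : ∀ v → adj v v ≡ false

toFinGraph : ∀ {n} → SimpleGraph n → FinGraph
toFinGraph {n} G = record
  { Vtx = Fin n ; vertices = allFin n ; adj = SimpleGraph.adj G }

card : ∀ {n} → (Fin n → Bool) → ℕ
card {n} S = length (filterᵇ S (allFin n))

IsTVD : ∀ {n} → SimpleGraph n → (Fin n → ℕ) → (Fin n → Bool) → Set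
IsTVD G k S = ∀ v → k v ≤ length (filterᵇ S (N (toFinGraph G) v))

IsMinimum : {A : Set} → (A → Set) → (A → ℕ) → ℕ → Set
IsMinimum {A} P size m = (∃[ x ] (P x × size x ≡ m)) × (∀ x → P x → m ≤ size x)

module Construction {n : ℕ} (G : SimpleGraph n) (k : Fin n → ℕ) where

  dG : Fin n → ℕ
  dG = deg (toFinGraph G)

  B : Fin n → ℤ
  B v = (+ (2 * k v + 1)) ℤ.- (+ dG v)

  nonneg : Fin n → Bool
  nonneg v with B v
  ... | + _      = true
  ... | -[1+ _ ] = false

  gadCount : Fin n → ℕ
  gadCount v = ∣ B v ∣

  gadLen : Fin n → ℕ
  gadLen v with B v
  ... | + _      = 3
  ... | -[1+ _ ] = 2

  data V' : Set where
    orig : Fin n → V'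
    pend : Fin n → Fin 2 → V'                                -- the 2-path at v; pend v 0 adjacent to v
    gad  : (v : Fin n) → Fin (gadCount v) → Fin (gadLen v) → V'
      -- gad v i j : j-th vertex of the i-th attached path at v; j = 0 is adjacent to v

  eqF : ∀ {m} → Fin m → Fin m → Bool
  eqF a b = does (a Fin.≟ b)

  consecutive : ℕ → ℕ → Bool
  consecutive a b = (suc a ≡ᵇ b) ∨ (suc b ≡ᵇ a)

  adj' : V' → V' → Bool
  adj' (orig u)    (orig v)    = SimpleGraph.adj G u v
  adj' (orig u)    (pend v j)  = eqF u v ∧ (toℕ j ≡ᵇ 0)
  adj' (pend v j)  (orig u)    = eqF u v ∧ (toℕ j ≡ᵇ 0)
  adj' (orig u)    (gad v i j) = eqF u v ∧ (toℕ j ≡ᵇ 0)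
  adj' (gad v i j) (orig u)    = eqF u v ∧ (toℕ j ≡ᵇ 0)
  adj' (pend v j)  (pend w j') = eqF v w ∧ consecutive (toℕ j) (toℕ j')
  adj' (gad v i j) (gad w i' j') =
    eqF v w ∧ (toℕ i ≡ᵇ toℕ i') ∧ consecutive (toℕ j) (toℕ j')
  adj' (pend _ _)  (gad _ _ _) = false
  adj' (gad _ _ _) (pend _ _)  = false

  vertices' : List V'
  vertices' =
    map orig (allFin n) ++
    concatMap (λ v → map (pend v) (allFin 2) ++
                     concatMap (λ i → map (gad v i) (allFin (gadLen v)))
                               (allFin (gadCount v)))
              (allFin n)

  G' : FinGraph
  G' = record { Vtx = V' ; vertices = vertices' ; adj = adj' }

  f : V' → Bool
  f (orig _)    = true
  f (pend _ _)  = false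
  f (gad v _ j) = nonneg v ∧ (toℕ j ≡ᵇ 0)

  relabel : (Fin n → Bool) → V' → Bool
  relabel S (orig v) = not (S v)
  relabel S u        = f u

-- Write s = |S ∩ N(v)| and d = d_G(v). Under relabel S an original vertex v has d − s neighbours
-- labelled 1 and s labelled 0 in G, one pendant neighbour labelled 0, and |B(v)| further attached
-- neighbours, labelled 1 if B(v) ≥ 0 and 0 otherwise. Since B(v) = 2k(v) + 1 − d, its ones exceed its
-- zeros by exactly 2(k(v) − s), while no vertex on an attached path sees more ones than zeros. So
-- relabel S induces no illusion iff S is a total vector dominating set, and it changes |S| vertices.
-- Conversely, let f′ induce no illusion and let S be the set of original vertices f′ sets to 0. Near
-- each v, f′ differs from relabel S only on the e(v) attached neighbours of v that f′ changes, so the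
-- same count gives k(v) ≤ s + e(v). As k ≤ d, a vertex short of k(v) has a neighbour outside S, and
-- adding it lowers the total deficit Σ (k(v) − s)⁺ by at least one; repeating yields a total vector
-- dominating set of size at most |S| + Σ e(v) ≤ dist(f, f′).

module Submission where

open import Defs
open import Data.Bool using (Bool; true; false; not; _∧_; _∨_; _xor_; if_then_else_)
open import Data.Bool.Properties using (not-involutive; xor-same)
open import Data.Nat
  using (ℕ; zero; suc; _+_; _*_; _∸_; _≤_; _<_; _≡ᵇ_; z≤n; s≤s; s≤s⁻¹; _≤?_; _<?_)
import Data.Nat as ℕ
open import Data.Nat.Properties
open import Data.Nat.ListAction using (sum)
open import Data.Nat.Induction using (<-wellFounded)
open import Data.Nat.Tactic.RingSolver using (solve-∀)
import Data.Integer as ℤ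
open import Data.Integer using (_⊖_)
import Data.Integer.Properties as ℤP
open import Data.Fin using (Fin; toℕ) renaming (zero to fz; suc to fs)
import Data.Fin.Properties as Fin
open import Data.Fin.Subset.Properties using (anySubset?)
import Data.Vec as Vec
import Data.Vec.Properties as Vec
open import Data.List using (List; []; _∷_; _++_; length; map; concat; concatMap; filterᵇ; allFin)
open import Data.List.Properties
  using (filter-++; map-cong; length-++; length-map; length-tabulate; map-tabulate; concatMap-cong; ++-identityʳ)
open import Data.List.Relation.Unary.All as All using (All; []; _∷_)
import Data.List.Relation.Unary.All.Properties as All
open import Data.List.Relation.Unary.Any using (here; there)
open import Data.List.Membership.Propositional using (_∈_)
open import Data.List.Membership.Propositional.Properties using (∈-allFin)
open import Data.Product using (∃-syntax; _×_; _,_)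
open import Function using (_∘_; id; case_of_)
open import Function.Bundles using (_⇔_; mk⇔; Equivalence)
open import Induction.WellFounded using (Acc; acc)
open import Relation.Nullary using (¬_; Dec; yes; no; does)
open import Relation.Nullary.Decidable using (T?; dec-true; dec-false; _×-dec_)
open import Relation.Binary.PropositionalEquality

private
  variable
    A C : Set

count : (A → Bool) → List A → ℕ
count p xs = length (filterᵇ p xs)

filterᵇ-cong-All : ∀ {p q : A → Bool} {xs} → All (λ x → p x ≡ q x) xs →
                   filterᵇ p xs ≡ filterᵇ q xs
filterᵇ-cong-All [] = refl
filterᵇ-cong-All {p = p} {q} {x ∷ _} (px≡qx ∷ rest) with p x | q x | px≡qx
... | true  | .true  | refl = cong (x ∷_) (filterᵇ-cong-All rest)
... | false | .false | refl = filterᵇ-cong-All rest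

filterᵇ-none : ∀ {p : A → Bool} {xs} → All (λ x → p x ≡ false) xs → filterᵇ p xs ≡ []
filterᵇ-none [] = refl
filterᵇ-none {p = p} {x ∷ _} (px≡false ∷ rest) with p x | px≡false
... | false | refl = filterᵇ-none rest

filterᵇ-as-concatMap : ∀ (p : A → Bool) xs → filterᵇ p xs ≡ concatMap (λ x → filterᵇ p (x ∷ [])) xs
filterᵇ-as-concatMap p [] = refl
filterᵇ-as-concatMap p (x ∷ xs) with p x
... | true  = cong (x ∷_) (filterᵇ-as-concatMap p xs)
... | false = filterᵇ-as-concatMap p xs

filterᵇ-map : ∀ (p : C → Bool) (h : A → C) xs → filterᵇ p (map h xs) ≡ map h (filterᵇ (p ∘ h) xs)
filterᵇ-map p h [] = refl
filterᵇ-map p h (x ∷ xs) with p (h x)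
... | true  = cong (h x ∷_) (filterᵇ-map p h xs)
... | false = filterᵇ-map p h xs

filterᵇ-concatMap : ∀ (p : C → Bool) (F : A → List C) xs →
                    filterᵇ p (concatMap F xs) ≡ concatMap (filterᵇ p ∘ F) xs
filterᵇ-concatMap p F [] = refl
filterᵇ-concatMap p F (x ∷ xs) =
  trans (filter-++ (T? ∘ p) (F x) _) (cong (filterᵇ p (F x) ++_) (filterᵇ-concatMap p F xs))

concatMap-none : {F : A → List C} → (∀ x → F x ≡ []) → ∀ xs → concatMap F xs ≡ []
concatMap-none F≡[] [] = refl
concatMap-none F≡[] (x ∷ xs) = cong₂ _++_ (F≡[] x) (concatMap-none F≡[] xs)

count-cong : ∀ {p q : A → Bool} → (∀ x → p x ≡ q x) → ∀ xs → count p xs ≡ count q xs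
count-cong p≗q xs = cong length (filterᵇ-cong-All (All.universal p≗q xs))

count-none : ∀ {p : A → Bool} {xs} → All (λ x → p x ≡ false) xs → count p xs ≡ 0
count-none = cong length ∘ filterᵇ-none

count-true : ∀ (xs : List A) → count (λ _ → true) xs ≡ length xs
count-true [] = refl
count-true (_ ∷ xs) = cong suc (count-true xs)

count-++ : ∀ (p : A → Bool) xs ys → count p (xs ++ ys) ≡ count p xs + count p ys
count-++ p xs ys = trans (cong length (filter-++ (T? ∘ p) xs ys)) (length-++ (filterᵇ p xs))

count-map : ∀ (p : C → Bool) (h : A → C) xs → count p (map h xs) ≡ count (p ∘ h) xs
count-map p h xs = trans (cong length (filterᵇ-map p h xs)) (length-map h (filterᵇ (p ∘ h) xs))

count-concatMap : ∀ (p : C → Bool) (F : A → List C) xs →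
                  count p (concatMap F xs) ≡ sum (map (count p ∘ F) xs)
count-concatMap p F [] = refl
count-concatMap p F (x ∷ xs) =
  trans (count-++ p (F x) (concatMap F xs)) (cong (count p (F x) +_) (count-concatMap p F xs))

count-not+count : ∀ (p : A → Bool) xs → count (not ∘ p) xs + count p xs ≡ length xs
count-not+count p [] = refl
count-not+count p (x ∷ xs) with p x
... | true  = trans (+-suc _ _) (cong suc (count-not+count p xs))
... | false = cong suc (count-not+count p xs)

count-filterᵇ-≤ : ∀ (p q : A → Bool) xs → count p (filterᵇ q xs) ≤ count p xs
count-filterᵇ-≤ p q [] = z≤n
count-filterᵇ-≤ p q (x ∷ xs) with q x
... | true  with p x
...   | true  = s≤s (count-filterᵇ-≤ p q xs)
...   | false = count-filterᵇ-≤ p q xs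
count-filterᵇ-≤ p q (x ∷ xs) | false with p x
...   | true  = m≤n⇒m≤1+n (count-filterᵇ-≤ p q xs)
...   | false = count-filterᵇ-≤ p q xs

count-xor : ∀ (p q : A → Bool) xs → count p xs ≤ count q xs + count (λ x → p x xor q x) xs
count-xor p q [] = z≤n
count-xor p q (x ∷ xs) with p x | q x
... | true  | true  = s≤s (count-xor p q xs)
... | true  | false = ≤-trans (s≤s (count-xor p q xs)) (≤-reflexive (sym (+-suc (count q xs) _)))
... | false | true  = ≤-trans (count-xor p q xs) (+-mono-≤ (n≤1+n _) (n≤1+n _))
... | false | false = count-xor p q xs

count-mono : ∀ {p q : A → Bool} → (∀ x → p x ≡ true → q x ≡ true) → ∀ xs → count p xs ≤ count q xs
count-mono p⇒q [] = z≤n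
count-mono {p = p} {q} p⇒q (x ∷ xs) with p x in px | q x in qx
... | true  | true  = s≤s (count-mono p⇒q xs)
... | true  | false = case trans (sym (p⇒q x px)) qx of λ ()
... | false | true  = m≤n⇒m≤1+n (count-mono p⇒q xs)
... | false | false = count-mono p⇒q xs

count-< : ∀ {p q : A → Bool} {y xs} → (∀ x → p x ≡ true → q x ≡ true) →
          y ∈ xs → p y ≡ false → q y ≡ true → count p xs < count q xs
count-< {p = p} {q} {y} {_ ∷ xs} p⇒q (here refl) py qy with p y | q y | py | qy
... | .false | .true | refl | refl = s≤s (count-mono p⇒q xs)
count-< {p = p} {q} {_} {x ∷ _} p⇒q (there y∈) py qy with p x in px | q x in qx
... | true  | true  = s≤s (count-< p⇒q y∈ py qy)
... | true  | false = case trans (sym (p⇒q x px)) qx of λ ()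
... | false | true  = m<n⇒m<1+n (count-< p⇒q y∈ py qy)
... | false | false = count-< p⇒q y∈ py qy

count-∨ : ∀ {p q : A → Bool} → (∀ x → p x ≡ true → q x ≡ false) →
          ∀ xs → count (λ x → p x ∨ q x) xs ≡ count p xs + count q xs
count-∨ disjoint [] = refl
count-∨ {p = p} {q} disjoint (x ∷ xs) with p x in px | q x in qx
... | true  | true  = case trans (sym (disjoint x px)) qx of λ ()
... | true  | false = cong suc (count-∨ disjoint xs)
... | false | true  = trans (cong suc (count-∨ disjoint xs)) (sym (+-suc _ _))
... | false | false = count-∨ disjoint xs

count<length⇒∃false : ∀ (p : A → Bool) xs → count p xs < length xs →
                      ∃[ x ] (x ∈ xs × p x ≡ false)
count<length⇒∃false p (x ∷ xs) lt with p x in px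
... | false = x , here refl , px
... | true  with count<length⇒∃false p xs (s≤s⁻¹ lt)
...   | y , y∈xs , py = y , there y∈xs , py

sum-map-mono : ∀ {g h : A → ℕ} → (∀ x → g x ≤ h x) → ∀ xs → sum (map g xs) ≤ sum (map h xs)
sum-map-mono g≤h [] = z≤n
sum-map-mono g≤h (x ∷ xs) = +-mono-≤ (g≤h x) (sum-map-mono g≤h xs)

sum-map-< : ∀ {g h : A → ℕ} {y xs} → (∀ x → g x ≤ h x) → y ∈ xs → g y < h y →
            sum (map g xs) < sum (map h xs)
sum-map-< g≤h (here {xs = xs} refl) gy<hy = +-mono-<-≤ gy<hy (sum-map-mono g≤h xs)
sum-map-< g≤h (there y∈xs) gy<hy = +-mono-≤-< (g≤h _) (sum-map-< g≤h y∈xs gy<hy)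

sum-map-const : ∀ c (xs : List A) → sum (map (λ _ → c) xs) ≡ length xs * c
sum-map-const c [] = refl
sum-map-const c (_ ∷ xs) = cong (c +_) (sum-map-const c xs)

concatMap-allFin-suc : ∀ {n} (F : Fin (suc n) → List A) →
                       concatMap F (allFin (suc n)) ≡ F fz ++ concatMap (F ∘ fs) (allFin n)
concatMap-allFin-suc F =
  cong (F fz ++_) (cong concat (trans (map-tabulate fs F) (sym (map-tabulate id (F ∘ fs)))))

concatMap-allFin-single : ∀ {n} (F : Fin n → List A) v → (∀ w → w ≢ v → F w ≡ []) →
                          concatMap F (allFin n) ≡ F v
concatMap-allFin-single {n = suc n} F fz others = begin
  concatMap F (allFin (suc n))           ≡⟨ concatMap-allFin-suc F ⟩
  F fz ++ concatMap (F ∘ fs) (allFin n)  ≡⟨ cong (F fz ++_) (concatMap-none (λ w → others (fs w) λ ()) (allFin n)) ⟩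
  F fz ++ []                             ≡⟨ ++-identityʳ (F fz) ⟩
  F fz                                   ∎
  where open ≡-Reasoning
concatMap-allFin-single {n = suc n} F (fs v) others = begin
  concatMap F (allFin (suc n))           ≡⟨ concatMap-allFin-suc F ⟩
  F fz ++ concatMap (F ∘ fs) (allFin n)  ≡⟨ cong (_++ concatMap (F ∘ fs) (allFin n)) (others fz λ ()) ⟩
  concatMap (F ∘ fs) (allFin n)          ≡⟨ concatMap-allFin-single (F ∘ fs) v others′ ⟩
  F (fs v)                               ∎
  where
  open ≡-Reasoning
  others′ : ∀ w → w ≢ v → F (fs w) ≡ []
  others′ w w≢v = others (fs w) (w≢v ∘ Fin.suc-injective)

filterᵇ-allFin-single : ∀ {n} (p : Fin n → Bool) v → (∀ w → w ≢ v → p w ≡ false) →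
                        filterᵇ p (allFin n) ≡ filterᵇ p (v ∷ [])
filterᵇ-allFin-single p v others =
  trans (filterᵇ-as-concatMap p (allFin _))
        (concatMap-allFin-single _ v (λ w w≢v → filterᵇ-none {p = p} (others w w≢v ∷ [])))

count-≟-allFin : ∀ {n} (v : Fin n) → count (λ w → does (w Fin.≟ v)) (allFin n) ≡ 1
count-≟-allFin v
  rewrite filterᵇ-allFin-single (λ w → does (w Fin.≟ v)) v (λ w → dec-false (w Fin.≟ v))
        | dec-true (v Fin.≟ v) refl = refl

module _ {n : ℕ} {P : (Fin n → Bool) → Set} (size : (Fin n → Bool) → ℕ)
         (P? : ∀ S → Dec (P S))
         (P-resp : ∀ {S T} → (∀ i → S i ≡ T i) → P S → P T)
         (size-resp : ∀ {S T} → (∀ i → S i ≡ T i) → size S ≡ size T) where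

  private
    smaller? : ∀ c → Dec (∃[ S ] (P S × size S < c))
    smaller? c with anySubset? (λ s → P? (Vec.lookup s) ×-dec (size (Vec.lookup s) <? c))
    ... | yes (s , Ps , lt) = yes (Vec.lookup s , Ps , lt)
    ... | no none = no λ (S , PS , lt) →
      let S≗ = λ i → sym (Vec.lookup∘tabulate S i) in
      none (Vec.tabulate S , P-resp S≗ PS , subst (_< c) (size-resp S≗) lt)

  minimum-exists : ∀ S → P S → ∃[ m ] IsMinimum P size m
  minimum-exists S PS = descend S PS (<-wellFounded (size S))
    where
    descend : ∀ S → P S → Acc _<_ (size S) → ∃[ m ] IsMinimum P size m
    descend S PS (acc smaller) with smaller? (size S)
    ... | yes (T , PT , lt) = descend T PT (smaller lt)
    ... | no none = size S , (S , PS , refl) , λ T PT → ≮⇒≥ (λ lt → none (T , PT , lt))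

module TotalVectorDomination {n : ℕ} (G : SimpleGraph n) (k : Fin n → ℕ) where

  private
    Nᴳ : Fin n → List (Fin n)
    Nᴳ = N (toFinGraph G)

  IsTVD? : ∀ S → Dec (IsTVD G k S)
  IsTVD? S = Fin.all? (λ v → k v ≤? count S (Nᴳ v))

  IsTVD-resp : ∀ {S T} → (∀ i → S i ≡ T i) → IsTVD G k S → IsTVD G k T
  IsTVD-resp S≗T tvd v = subst (k v ≤_) (count-cong S≗T (Nᴳ v)) (tvd v)

  card-resp : ∀ {S T : Fin n → Bool} → (∀ i → S i ≡ T i) → card S ≡ card T
  card-resp S≗T = count-cong S≗T (allFin n)

  everything-IsTVD : (∀ v → k v ≤ deg (toFinGraph G) v) → IsTVD G k (λ _ → true)
  everything-IsTVD k≤deg v = subst (k v ≤_) (sym (count-true (Nᴳ v))) (k≤deg v)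

  deficit : (Fin n → Bool) → Fin n → ℕ
  deficit S v = k v ∸ count S (Nᴳ v)

  totalDeficit : (Fin n → Bool) → ℕ
  totalDeficit S = sum (map (deficit S) (allFin n))

  insert : Fin n → (Fin n → Bool) → Fin n → Bool
  insert u S w = S w ∨ does (w Fin.≟ u)

  private
    ⊆-insert : ∀ u S w → S w ≡ true → insert u S w ≡ true
    ⊆-insert u S w Sw = cong (_∨ does (w Fin.≟ u)) Sw

  card-insert : ∀ {u S} → S u ≡ false → card (insert u S) ≡ suc (card S)
  card-insert {u} {S} Su = begin
    card (insert u S)                                    ≡⟨ count-∨ u∉S (allFin n) ⟩
    card S + count (λ w → does (w Fin.≟ u)) (allFin n)  ≡⟨ cong (card S +_) (count-≟-allFin u) ⟩
    card S + 1                                           ≡⟨ +-comm (card S) 1 ⟩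
    suc (card S)                                         ∎
    where
    open ≡-Reasoning
    u∉S : ∀ w → S w ≡ true → does (w Fin.≟ u) ≡ false
    u∉S w Sw = dec-false (w Fin.≟ u) λ { refl → case trans (sym Sw) Su of λ () }

  totalDeficit-insert : ∀ {u v S} → u ∈ Nᴳ v → S u ≡ false → count S (Nᴳ v) < k v →
                        totalDeficit (insert u S) < totalDeficit S
  totalDeficit-insert {u} {v} {S} u∈Nv Su s<k =
    sum-map-< (λ w → ∸-monoʳ-≤ (k w) (count-mono (⊆-insert u S) (Nᴳ w))) (∈-allFin v)
              (≤-<-trans (∸-monoʳ-≤ (k v) s<s′) (∸-monoʳ-< (n<1+n _) s<k))
    where
    s<s′ : count S (Nᴳ v) < count (insert u S) (Nᴳ v)
    s<s′ = count-< (⊆-insert u S) u∈Nv Su (trans (cong (_∨ _) Su) (dec-true (u Fin.≟ u) refl))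

  improvable : (∀ v → k v ≤ deg (toFinGraph G) v) → ∀ S → ¬ IsTVD G k S →
               ∃[ u ] (S u ≡ false × totalDeficit (insert u S) < totalDeficit S)
  improvable k≤deg S ¬tvd with Fin.¬∀⟶∃¬ n _ (λ v → k v ≤? count S (Nᴳ v)) ¬tvd
  ... | v , k≰s with count<length⇒∃false S (Nᴳ v) (<-≤-trans (≰⇒> k≰s) (k≤deg v))
  ...   | u , u∈Nv , Su = u , Su , totalDeficit-insert u∈Nv Su (≰⇒> k≰s)

  repair : (∀ v → k v ≤ deg (toFinGraph G) v) →
           ∀ S → ∃[ T ] (IsTVD G k T × card T ≤ card S + totalDeficit S)
  repair k≤deg S = go S (<-wellFounded (totalDeficit S))
    where
    go : ∀ S → Acc _<_ (totalDeficit S) →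
         ∃[ T ] (IsTVD G k T × card T ≤ card S + totalDeficit S)
    go S (acc smaller) with IsTVD? S
    ... | yes tvd = S , tvd , m≤m+n (card S) (totalDeficit S)
    ... | no ¬tvd with improvable k≤deg S ¬tvd
    ...   | u , Su , decrease with go (insert u S) (smaller decrease)
    ...     | T , tvd , bound = T , tvd , (begin
      card T                           ≤⟨ bound ⟩
      card S′ + totalDeficit S′        ≡⟨ cong (_+ totalDeficit S′) (card-insert Su) ⟩
      suc (card S + totalDeficit S′)   ≡⟨ sym (+-suc (card S) (totalDeficit S′)) ⟩
      card S + suc (totalDeficit S′)   ≤⟨ +-monoʳ-≤ (card S) decrease ⟩
      card S + totalDeficit S          ∎)
      where
      open ≤-Reasoning
      S′ = insert u S

⊖≡+⇒ : ∀ m n {o} → m ⊖ n ≡ ℤ.+ o → m ≡ n + o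
⊖≡+⇒ zero    zero    eq = ℤP.+-injective eq
⊖≡+⇒ (suc m) zero    eq = ℤP.+-injective eq
⊖≡+⇒ (suc m) (suc n) eq = cong suc (⊖≡+⇒ m n (trans (sym (ℤP.[1+m]⊖[1+n]≡m⊖n m n)) eq))

⊖≡-[1+]⇒ : ∀ m n {o} → m ⊖ n ≡ ℤ.-[1+ o ] → n ≡ m + suc o
⊖≡-[1+]⇒ zero    (suc n) eq = cong suc (ℤP.-[1+-injective eq)
⊖≡-[1+]⇒ (suc m) (suc n) eq = cong suc (⊖≡-[1+]⇒ m n (trans (sym (ℤP.[1+m]⊖[1+n]≡m⊖n m n)) eq))

excess-≤ : ∀ {o z s t} d → o + 2 * s ≡ z + 2 * t → o ≤ z + (d + d) → t ≤ s + d
excess-≤ {o} {z} {s} {t} d eq o≤ = *-cancelˡ-≤ 2 (+-cancelˡ-≤ z (2 * t) (2 * (s + d)) (begin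
  z + 2 * t            ≡⟨ sym eq ⟩
  o + 2 * s            ≤⟨ +-monoˡ-≤ (2 * s) o≤ ⟩
  z + (d + d) + 2 * s  ≡⟨ regroup z d s ⟩
  z + 2 * (s + d)      ∎))
  where
  open ≤-Reasoning
  regroup : ∀ z d s → z + (d + d) + 2 * s ≡ z + 2 * (s + d)
  regroup = solve-∀

excess-≥ : ∀ {o z s t} → o + 2 * s ≡ z + 2 * t → t ≤ s → o ≤ z
excess-≥ {o} {z} {s} {t} eq t≤s = +-cancelʳ-≤ (2 * s) o z (begin
  o + 2 * s  ≡⟨ eq ⟩
  z + 2 * t  ≤⟨ +-monoʳ-≤ z (*-monoʳ-≤ 2 t≤s) ⟩
  z + 2 * s  ∎)
  where open ≤-Reasoning

not-xor-not : ∀ x y → not x xor not y ≡ y xor x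
not-xor-not true  true  = refl
not-xor-not true  false = refl
not-xor-not false true  = refl
not-xor-not false false = refl

module Reduction {n : ℕ} (G : SimpleGraph n) (k : Fin n → ℕ) where
  open Construction G k
  open TotalVectorDomination G k

  private
    Nᴳ : Fin n → List (Fin n)
    Nᴳ = N (toFinGraph G)

    isFirst : ∀ {m} → Fin m → Bool
    isFirst j = toℕ j ≡ᵇ 0

  attached : Fin n → List V'
  attached v = map (pend v) (allFin 2) ++
               concatMap (λ i → map (gad v i) (allFin (gadLen v))) (allFin (gadCount v))

  All-attached : ∀ {P : V' → Set} v → (∀ j → P (pend v j)) → (∀ i j → P (gad v i j)) →
                 All P (attached v)
  All-attached v Pp Pg =
    All.++⁺ (All.map⁺ {f = pend v} (All.tabulate⁺ {f = id} Pp))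
            (All.concat⁺ (All.map⁺ (All.tabulate⁺ {f = id} λ i →
                                      All.map⁺ {f = gad v i} (All.tabulate⁺ {f = id} (Pg i)))))

  filterᵇ-attached : ∀ p v → filterᵇ p (attached v) ≡
    map (pend v) (filterᵇ (p ∘ pend v) (allFin 2)) ++
    concatMap (λ i → map (gad v i) (filterᵇ (p ∘ gad v i) (allFin (gadLen v)))) (allFin (gadCount v))
  filterᵇ-attached p v =
    trans (filter-++ (T? ∘ p) (map (pend v) (allFin 2)) _)
          (cong₂ _++_ (filterᵇ-map p (pend v) (allFin 2))
                      (trans (filterᵇ-concatMap p _ (allFin (gadCount v)))
                             (concatMap-cong (λ i → filterᵇ-map p (gad v i) (allFin (gadLen v)))
                                             (allFin (gadCount v)))))

  count-vertices' : ∀ p → count p vertices' ≡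
                    count (p ∘ orig) (allFin n) + count p (concatMap attached (allFin n))
  count-vertices' p =
    trans (count-++ p (map orig (allFin n)) (concatMap attached (allFin n)))
          (cong (_+ count p (concatMap attached (allFin n))) (count-map p orig (allFin n)))

  private
    at-root : ∀ (v : Fin n) b → (does (v Fin.≟ v) ∧ b) ≡ b
    at-root v b = cong (_∧ b) (dec-true (v Fin.≟ v) refl)

    off-root : ∀ {v w : Fin n} → v ≢ w → ∀ b → (does (v Fin.≟ w) ∧ b) ≡ false
    off-root {v} {w} v≢w b = cong (_∧ b) (dec-false (v Fin.≟ w) v≢w)

  N-split : ∀ x v → (∀ w → v ≢ w → All (λ u → adj' x u ≡ false) (attached w)) →
            N G' x ≡ map orig (filterᵇ (adj' x ∘ orig) (allFin n)) ++ filterᵇ (adj' x) (attached v)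
  N-split x v far =
    trans (filter-++ (T? ∘ adj' x) (map orig (allFin n)) (concatMap attached (allFin n)))
          (cong₂ _++_ (filterᵇ-map (adj' x) orig (allFin n))
                      (trans (filterᵇ-concatMap (adj' x) attached (allFin n))
                             (concatMap-allFin-single _ v
                                (λ w w≢v → filterᵇ-none {p = adj' x} (far w (w≢v ∘ sym))))))

  root : ∀ {L} → Fin L → Fin n → List (Fin n)
  root j v = if isFirst j then v ∷ [] else []

  pathNeighbours : ∀ {L} → Fin L → List (Fin L)
  pathNeighbours {L} j = filterᵇ (consecutive (toℕ j) ∘ toℕ) (allFin L)

  filterᵇ-root : ∀ {L} (j : Fin L) v →
                 filterᵇ (λ w → does (w Fin.≟ v) ∧ isFirst j) (allFin n) ≡ root j v
  filterᵇ-root j v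
    rewrite filterᵇ-allFin-single (λ w → does (w Fin.≟ v) ∧ isFirst j) v
              (λ w w≢v → cong (_∧ isFirst j) (dec-false (w Fin.≟ v) w≢v))
          | dec-true (v Fin.≟ v) refl
    with isFirst j
  ... | true  = refl
  ... | false = refl

  attachedNeighbours : Fin n → List V'
  attachedNeighbours v = filterᵇ (adj' (orig v)) (attached v)

  N-orig : ∀ v → N G' (orig v) ≡ map orig (Nᴳ v) ++ attachedNeighbours v
  N-orig v = N-split (orig v) v λ w v≢w →
    All-attached w (λ _ → off-root v≢w _) (λ _ _ → off-root v≢w _)

  N-pend : ∀ v j → N G' (pend v j) ≡ map orig (root j v) ++ map (pend v) (pathNeighbours j)
  N-pend v j = trans (N-split (pend v j) v far) (cong₂ _++_ (cong (map orig) (filterᵇ-root j v)) path)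
    where
    far : ∀ w → v ≢ w → All (λ u → adj' (pend v j) u ≡ false) (attached w)
    far w v≢w = All-attached w (λ _ → off-root v≢w _) (λ _ _ → refl)
    no-gadgets : filterᵇ (λ _ → false) (allFin (gadLen v)) ≡ []
    no-gadgets = filterᵇ-none {p = λ _ → false} (All.universal (λ _ → refl) (allFin (gadLen v)))
    path : filterᵇ (adj' (pend v j)) (attached v) ≡ map (pend v) (pathNeighbours j)
    path = begin
      filterᵇ (adj' (pend v j)) (attached v)
        ≡⟨ filterᵇ-attached (adj' (pend v j)) v ⟩
      map (pend v) (filterᵇ (adj' (pend v j) ∘ pend v) (allFin 2)) ++
      concatMap (λ i → map (gad v i) (filterᵇ (λ _ → false) (allFin (gadLen v)))) (allFin (gadCount v))
        ≡⟨ cong₂ _++_ (cong (map (pend v)) (filterᵇ-cong-All (All.universal (λ _ → at-root v _) (allFin 2))))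
                      (concatMap-none (λ i → cong (map (gad v i)) no-gadgets) (allFin (gadCount v))) ⟩
      map (pend v) (pathNeighbours j) ++ []
        ≡⟨ ++-identityʳ _ ⟩
      map (pend v) (pathNeighbours j)
        ∎
      where open ≡-Reasoning

  N-gad : ∀ v i j → N G' (gad v i j) ≡ map orig (root j v) ++ map (gad v i) (pathNeighbours j)
  N-gad v i j = trans (N-split (gad v i j) v far) (cong₂ _++_ (cong (map orig) (filterᵇ-root j v)) path)
    where
    far : ∀ w → v ≢ w → All (λ u → adj' (gad v i j) u ≡ false) (attached w)
    far w v≢w = All-attached w (λ _ → refl) (λ _ _ → off-root v≢w _)
    -- adj' compares path indices with _≡ᵇ_, which is what does (_ ℕ.≟ _) computes to.
    other-path : ∀ i′ → i′ ≢ i → ∀ j′ → adj' (gad v i j) (gad v i′ j′) ≡ false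
    other-path i′ i′≢i j′ = trans (at-root v _) (cong (_∧ consecutive (toℕ j) (toℕ j′))
      (dec-false (toℕ i ℕ.≟ toℕ i′) (i′≢i ∘ sym ∘ Fin.toℕ-injective)))
    same-path : ∀ j′ → adj' (gad v i j) (gad v i j′) ≡ consecutive (toℕ j) (toℕ j′)
    same-path j′ = trans (at-root v _) (cong (_∧ consecutive (toℕ j) (toℕ j′))
      (dec-true (toℕ i ℕ.≟ toℕ i) refl))
    path : filterᵇ (adj' (gad v i j)) (attached v) ≡ map (gad v i) (pathNeighbours j)
    path = begin
      filterᵇ (adj' (gad v i j)) (attached v)
        ≡⟨ filterᵇ-attached (adj' (gad v i j)) v ⟩
      concatMap (λ i′ → map (gad v i′) (filterᵇ (adj' (gad v i j) ∘ gad v i′) (allFin (gadLen v))))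
                (allFin (gadCount v))
        ≡⟨ concatMap-allFin-single _ i (λ i′ i′≢i →
             cong (map (gad v i′)) (filterᵇ-none (All.universal (other-path i′ i′≢i) (allFin (gadLen v))))) ⟩
      map (gad v i) (filterᵇ (adj' (gad v i j) ∘ gad v i) (allFin (gadLen v)))
        ≡⟨ cong (map (gad v i)) (filterᵇ-cong-All (All.universal same-path (allFin (gadLen v)))) ⟩
      map (gad v i) (pathNeighbours j)
        ∎
      where open ≡-Reasoning

  Balanced : (V' → Bool) → List V' → Set
  Balanced g us = count g us ≤ count (not ∘ g) us

  balanced⇒¬illusion : ∀ g x {us} → N G' x ≡ us → Balanced g us → ¬ UnderIllusion G' g x
  balanced⇒¬illusion g x Nx≡us bal = ≤⇒≯ (subst (Balanced g) (sym Nx≡us) bal)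

  private
    singleton-balanced : ∀ g {y} → g y ≡ false → Balanced g (y ∷ [])
    singleton-balanced g {y} gy rewrite gy = z≤n

    pair-balanced : ∀ g x {y} → g y ≡ false → Balanced g (x ∷ y ∷ [])
    pair-balanced g x gy with g x
    ... | true  rewrite gy = s≤s z≤n
    ... | false rewrite gy = z≤n

  -- PathLabels L b: the labels along an attached path of L vertices, read from the end adjacent
  -- to the original vertex, are b, 0, …, 0.
  data PathLabels : ℕ → Bool → Set where
    one-zero-zero : PathLabels 3 true
    zero-zero     : PathLabels 2 false

  path-labels : ∀ v → PathLabels (gadLen v) (nonneg v)
  path-labels v with B v
  ... | ℤ.+ _      = one-zero-zero
  ... | ℤ.-[1+ _ ] = zero-zero

  path-balanced : ∀ {L b} → PathLabels L b → ∀ g (h : Fin L → V') →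
                  (∀ j → g (h j) ≡ b ∧ isFirst j) →
                  ∀ v j → Balanced g (map orig (root j v) ++ map h (pathNeighbours j))
  path-balanced one-zero-zero g h label v fz           = pair-balanced g (orig v) (label (fs fz))
  path-balanced one-zero-zero g h label v (fs fz)      = pair-balanced g (h fz) (label (fs (fs fz)))
  path-balanced one-zero-zero g h label v (fs (fs fz)) = singleton-balanced g (label (fs fz))
  path-balanced zero-zero     g h label v fz           = pair-balanced g (orig v) (label (fs fz))
  path-balanced zero-zero     g h label v (fs fz)      = singleton-balanced g (label fz)

  gadgetEnds : Fin n → List V'
  gadgetEnds v =
    concatMap (λ i → map (gad v i) (filterᵇ isFirst (allFin (gadLen v)))) (allFin (gadCount v))

  attachedNeighbours≡ : ∀ v → attachedNeighbours v ≡ pend v fz ∷ gadgetEnds v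
  attachedNeighbours≡ v =
    trans (filterᵇ-attached (adj' (orig v)) v)
          (cong₂ _++_ (cong (map (pend v)) (first-only (allFin 2)))
                      (concatMap-cong (λ i → cong (map (gad v i)) (first-only (allFin (gadLen v))))
                                      (allFin (gadCount v))))
    where
    first-only : ∀ {L} (js : List (Fin L)) →
                 filterᵇ (λ j → does (v Fin.≟ v) ∧ isFirst j) js ≡ filterᵇ isFirst js
    first-only js = filterᵇ-cong-All (All.universal (λ _ → at-root v _) js)

  attachedNeighbours-agree : ∀ {p q : V' → Bool} v →
               (∀ j → p (pend v j) ≡ q (pend v j)) → (∀ i j → p (gad v i j) ≡ q (gad v i j)) →
               count p (attachedNeighbours v) ≡ count q (attachedNeighbours v)
  attachedNeighbours-agree v on-pend on-gad =
    cong length (filterᵇ-cong-All (All.filter⁺ (T? ∘ adj' (orig v)) (All-attached v on-pend on-gad)))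

  private
    first-label : ∀ {L b} → PathLabels L b → ∀ (φ : Bool → Bool) →
                  count (λ j → φ (b ∧ isFirst j)) (filterᵇ isFirst (allFin L)) ≡ count φ (b ∷ [])
    first-label one-zero-zero φ = sym (count-map φ (λ j → true  ∧ isFirst j) (filterᵇ isFirst (allFin 3)))
    first-label zero-zero     φ = sym (count-map φ (λ j → false ∧ isFirst j) (filterᵇ isFirst (allFin 2)))

  count-gadgetEnds : ∀ (φ : Bool → Bool) v → count (φ ∘ f) (gadgetEnds v) ≡ gadCount v * count φ (nonneg v ∷ [])
  count-gadgetEnds φ v = begin
    count (φ ∘ f) (gadgetEnds v)
      ≡⟨ count-concatMap (φ ∘ f) _ (allFin (gadCount v)) ⟩
    sum (map (λ i → count (φ ∘ f) (map (gad v i) firsts)) (allFin (gadCount v)))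
      ≡⟨ cong sum (map-cong (λ i → trans (count-map (φ ∘ f) (gad v i) firsts) (first-label (path-labels v) φ))
                            (allFin (gadCount v))) ⟩
    sum (map (λ _ → count φ (nonneg v ∷ [])) (allFin (gadCount v)))
      ≡⟨ sum-map-const _ (allFin (gadCount v)) ⟩
    length (allFin (gadCount v)) * count φ (nonneg v ∷ [])
      ≡⟨ cong (_* count φ (nonneg v ∷ [])) (length-tabulate {n = gadCount v} id) ⟩
    gadCount v * count φ (nonneg v ∷ [])
      ∎
    where
    open ≡-Reasoning
    firsts = filterᵇ isFirst (allFin (gadLen v))

  B≡⊖ : ∀ v → B v ≡ (2 * k v + 1) ⊖ dG v
  B≡⊖ v = ℤP.[+m]-[+n]≡m⊖n (2 * k v + 1) (dG v)

  B-balance : ∀ v → dG v + gadCount v * count id (nonneg v ∷ []) ≡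
                    2 * k v + suc (gadCount v * count not (nonneg v ∷ []))
  B-balance v with B v in B≡
  ... | ℤ.+ b = begin
    dG v + b * 1           ≡⟨ cong (dG v +_) (*-identityʳ b) ⟩
    dG v + b               ≡⟨ sym (⊖≡+⇒ (2 * k v + 1) (dG v) (trans (sym (B≡⊖ v)) B≡)) ⟩
    2 * k v + 1            ≡⟨ cong (λ z → 2 * k v + suc z) (sym (*-zeroʳ b)) ⟩
    2 * k v + suc (b * 0)  ∎
    where open ≡-Reasoning
  ... | ℤ.-[1+ b ] = begin
    dG v + suc b * 0           ≡⟨ trans (cong (dG v +_) (*-zeroʳ b)) (+-identityʳ (dG v)) ⟩
    dG v                       ≡⟨ ⊖≡-[1+]⇒ (2 * k v + 1) (dG v) (trans (sym (B≡⊖ v)) B≡) ⟩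
    2 * k v + 1 + suc b        ≡⟨ +-assoc (2 * k v) 1 (suc b) ⟩
    2 * k v + suc (suc b)      ≡⟨ cong (λ z → 2 * k v + suc z) (sym (*-identityʳ (suc b))) ⟩
    2 * k v + suc (suc b * 1)  ∎
    where open ≡-Reasoning

  balance : ∀ v → dG v + count f (attachedNeighbours v) ≡ 2 * k v + count (not ∘ f) (attachedNeighbours v)
  balance v = begin
    dG v + count f (attachedNeighbours v)
      ≡⟨ cong (λ us → dG v + count f us) (attachedNeighbours≡ v) ⟩
    dG v + count f (gadgetEnds v)
      ≡⟨ cong (dG v +_) (count-gadgetEnds id v) ⟩
    dG v + gadCount v * count id (nonneg v ∷ [])
      ≡⟨ B-balance v ⟩
    2 * k v + suc (gadCount v * count not (nonneg v ∷ []))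
      ≡⟨ cong (λ z → 2 * k v + suc z) (sym (count-gadgetEnds not v)) ⟩
    2 * k v + suc (count (not ∘ f) (gadgetEnds v))
      ≡⟨ cong (λ us → 2 * k v + count (not ∘ f) us) (sym (attachedNeighbours≡ v)) ⟩
    2 * k v + count (not ∘ f) (attachedNeighbours v)
      ∎
    where open ≡-Reasoning

  count-relabel-orig : ∀ (φ : Bool → Bool) S v →
    count (φ ∘ relabel S) (N G' (orig v)) ≡ count (φ ∘ not ∘ S) (Nᴳ v) + count (φ ∘ f) (attachedNeighbours v)
  count-relabel-orig φ S v =
    trans (cong (count (φ ∘ relabel S)) (N-orig v))
          (trans (count-++ (φ ∘ relabel S) (map orig (Nᴳ v)) (attachedNeighbours v))
                 (cong₂ _+_ (count-map (φ ∘ relabel S) orig (Nᴳ v)) (attachedNeighbours-agree v (λ _ → refl) (λ _ _ → refl))))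

  orig-excess : ∀ S v → ones G' (relabel S) (orig v) + 2 * count S (Nᴳ v) ≡
                        zeros G' (relabel S) (orig v) + 2 * k v
  orig-excess S v = begin
    ones G' (relabel S) (orig v) + 2 * s         ≡⟨ cong (_+ 2 * s) (count-relabel-orig id S v) ⟩
    a + cf + 2 * s                               ≡⟨ regroup₁ a cf s ⟩
    a + s + cf + s                               ≡⟨ cong (λ d → d + cf + s) (count-not+count S (Nᴳ v)) ⟩
    dG v + cf + s                                ≡⟨ cong (_+ s) (balance v) ⟩
    2 * k v + cz + s                             ≡⟨ regroup₂ (2 * k v) cz s ⟩
    s + cz + 2 * k v                             ≡⟨ cong (λ z → z + cz + 2 * k v) s≡ ⟩
    count (not ∘ not ∘ S) (Nᴳ v) + cz + 2 * k v  ≡⟨ cong (_+ 2 * k v) (sym (count-relabel-orig not S v)) ⟩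
    zeros G' (relabel S) (orig v) + 2 * k v      ∎
    where
    open ≡-Reasoning
    s = count S (Nᴳ v)
    a = count (not ∘ S) (Nᴳ v)
    cf = count f (attachedNeighbours v)
    cz = count (not ∘ f) (attachedNeighbours v)
    s≡ : count S (Nᴳ v) ≡ count (not ∘ not ∘ S) (Nᴳ v)
    s≡ = count-cong (sym ∘ not-involutive ∘ S) (Nᴳ v)
    regroup₁ : ∀ a c s → a + c + 2 * s ≡ a + s + c + s
    regroup₁ = solve-∀
    regroup₂ : ∀ t c s → t + c + s ≡ s + c + t
    regroup₂ = solve-∀

  relabel-NoIllusion⇔IsTVD : ∀ S → NoIllusion G' (relabel S) ⇔ IsTVD G k S
  relabel-NoIllusion⇔IsTVD S = mk⇔ to from
    where
    to : NoIllusion G' (relabel S) → IsTVD G k S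
    to ni v = subst (k v ≤_) (+-identityʳ _)
                    (excess-≤ 0 (orig-excess S v) (m≤n⇒m≤n+o 0 (≮⇒≥ (ni (orig v)))))
    from : IsTVD G k S → NoIllusion G' (relabel S)
    from tvd (orig v)    = ≤⇒≯ (excess-≥ (orig-excess S v) (tvd v))
    from tvd (pend v j)  = balanced⇒¬illusion (relabel S) (pend v j) (N-pend v j)
                             (path-balanced zero-zero (relabel S) (pend v) (λ _ → refl) v j)
    from tvd (gad v i j) = balanced⇒¬illusion (relabel S) (gad v i j) (N-gad v i j)
                             (path-balanced (path-labels v) (relabel S) (gad v i) (λ _ → refl) v j)

  dist-relabel : ∀ S → dist G' f (relabel S) ≡ card S
  dist-relabel S = begin
    dist G' f (relabel S)
      ≡⟨ count-vertices' (λ u → f u xor relabel S u) ⟩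
    count (not ∘ not ∘ S) (allFin n) + count (λ u → f u xor relabel S u) (concatMap attached (allFin n))
      ≡⟨ cong₂ _+_ (count-cong (not-involutive ∘ S) (allFin n))
                   (count-none (All.concat⁺ (All.map⁺ (All.universal unchanged (allFin n))))) ⟩
    card S + 0
      ≡⟨ +-identityʳ (card S) ⟩
    card S
      ∎
    where
    open ≡-Reasoning
    unchanged : ∀ v → All (λ u → (f u xor relabel S u) ≡ false) (attached v)
    unchanged v = All-attached v (λ j → xor-same (f (pend v j))) (λ i j → xor-same (f (gad v i j)))

  changedOriginals : (V' → Bool) → Fin n → Bool
  changedOriginals f′ w = not (f′ (orig w))

  changesAt : (V' → Bool) → Fin n → ℕ
  changesAt f′ v = count (λ u → f u xor f′ u) (attached v)

  dist-split : ∀ f′ → dist G' f f′ ≡ card (changedOriginals f′) + sum (map (changesAt f′) (allFin n))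
  dist-split f′ = trans (count-vertices' (λ u → f u xor f′ u))
                        (cong (card (changedOriginals f′) +_) (count-concatMap _ attached (allFin n)))

  changes-near : ∀ f′ v →
                 count (λ u → relabel (changedOriginals f′) u xor f′ u) (N G' (orig v)) ≤ changesAt f′ v
  changes-near f′ v = begin
    count (λ u → h u xor f′ u) (N G' (orig v))
      ≡⟨ cong (count (λ u → h u xor f′ u)) (N-orig v) ⟩
    count (λ u → h u xor f′ u) (map orig (Nᴳ v) ++ attachedNeighbours v)
      ≡⟨ count-++ (λ u → h u xor f′ u) (map orig (Nᴳ v)) (attachedNeighbours v) ⟩
    count (λ u → h u xor f′ u) (map orig (Nᴳ v)) + count (λ u → h u xor f′ u) (attachedNeighbours v)
      ≡⟨ cong₂ _+_ (trans (count-map _ orig (Nᴳ v)) (count-none (All.universal same-at-orig (Nᴳ v))))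
                   (attachedNeighbours-agree v (λ _ → refl) (λ _ _ → refl)) ⟩
    count (λ u → f u xor f′ u) (attachedNeighbours v)
      ≤⟨ count-filterᵇ-≤ _ (adj' (orig v)) (attached v) ⟩
    changesAt f′ v
      ∎
    where
    open ≤-Reasoning
    h = relabel (changedOriginals f′)
    same-at-orig : ∀ w → (h (orig w) xor f′ (orig w)) ≡ false
    same-at-orig w =
      trans (cong (_xor f′ (orig w)) (not-involutive (f′ (orig w)))) (xor-same (f′ (orig w)))

  deficit-≤-changesAt : ∀ f′ → NoIllusion G' f′ → ∀ v → deficit (changedOriginals f′) v ≤ changesAt f′ v
  deficit-≤-changesAt f′ ni v = ≤-trans (m≤n+o⇒m∸n≤o (k v) (count S (Nᴳ v)) k≤s+E) (changes-near f′ v)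
    where
    S = changedOriginals f′
    h = relabel S
    E = count (λ u → h u xor f′ u) (N G' (orig v))
    ones≤zeros+2E : ones G' h (orig v) ≤ zeros G' h (orig v) + (E + E)
    ones≤zeros+2E = begin
      ones G' h (orig v)             ≤⟨ count-xor h f′ (N G' (orig v)) ⟩
      ones G' f′ (orig v) + E        ≤⟨ +-monoˡ-≤ E (≮⇒≥ (ni (orig v))) ⟩
      zeros G' f′ (orig v) + E       ≤⟨ +-monoˡ-≤ E (count-xor (not ∘ f′) (not ∘ h) (N G' (orig v))) ⟩
      zeros G' h (orig v) + count (λ u → not (f′ u) xor not (h u)) (N G' (orig v)) + E
                                     ≡⟨ cong (λ c → zeros G' h (orig v) + c + E)
                                          (count-cong (λ u → not-xor-not (f′ u) (h u)) (N G' (orig v))) ⟩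
      zeros G' h (orig v) + E + E    ≡⟨ +-assoc (zeros G' h (orig v)) E E ⟩
      zeros G' h (orig v) + (E + E)  ∎
      where open ≤-Reasoning
    k≤s+E : k v ≤ count S (Nᴳ v) + E
    k≤s+E = excess-≤ {ones G' h (orig v)} {zeros G' h (orig v)} E (orig-excess S v) ones≤zeros+2E

  TVD-within-dist : (∀ v → k v ≤ deg (toFinGraph G) v) →
                    ∀ f′ → NoIllusion G' f′ → ∃[ T ] (IsTVD G k T × card T ≤ dist G' f f′)
  TVD-within-dist k≤deg f′ ni with repair k≤deg (changedOriginals f′)
  ... | T , tvd , bound = T , tvd , (begin
    card T                                        ≤⟨ bound ⟩
    card S + totalDeficit S                       ≤⟨ +-monoʳ-≤ (card S) (sum-map-mono deficit≤ (allFin n)) ⟩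
    card S + sum (map (changesAt f′) (allFin n))  ≡⟨ sym (dist-split f′) ⟩
    dist G' f f′                                  ∎)
    where
    open ≤-Reasoning
    S = changedOriginals f′
    deficit≤ : ∀ v → deficit S v ≤ changesAt f′ v
    deficit≤ = deficit-≤-changesAt f′ ni

lemma2 : ∀ (n : ℕ) (G : SimpleGraph n) (k : Fin n → ℕ) →
    (∀ v → k v ≤ deg (toFinGraph G) v) →
    let open Construction G k in
    (∀ (S : Fin n → Bool) → (NoIllusion G' (relabel S) ⇔ IsTVD G k S))
    × (∃[ m ] (IsMinimum (NoIllusion G') (dist G' f) m
               × IsMinimum (IsTVD G k) card m))
lemma2 n G k k≤deg = relabel-NoIllusion⇔IsTVD , optimum
  where
  open Construction G k
  open TotalVectorDomination G k
  open Reduction G k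

  optimum : ∃[ m ] (IsMinimum (NoIllusion G') (dist G' f) m × IsMinimum (IsTVD G k) card m)
  optimum with minimum-exists card IsTVD? IsTVD-resp card-resp (λ _ → true) (everything-IsTVD k≤deg)
  ... | m , tvd-min@((S , tvd , card≡m) , minimal) = m , ((relabel S , no-illusion , dist≡m) , below) , tvd-min
    where
    no-illusion : NoIllusion G' (relabel S)
    no-illusion = Equivalence.from (relabel-NoIllusion⇔IsTVD S) tvd
    dist≡m : dist G' f (relabel S) ≡ m
    dist≡m = trans (dist-relabel S) card≡m
    below : ∀ f′ → NoIllusion G' f′ → m ≤ dist G' f f′
    below f′ ni with TVD-within-dist k≤deg f′ ni
    ... | T , tvd′ , T≤dist = ≤-trans (minimal T tvd′) T≤dist
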